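{- Let $q$ be a positive integer and $0<\alpha\le\frac12$, and let $A$ be the largest integer such that $\lceil q/A\rceil-1\ge\alpha(q-1)$. There is a constant $c_q$ depending only on $q$ such that if $n$ is large enough, then after asking all $\binom{n}{q}$ possible queries of size $q$ among $n$ balls, we can name a $c_q$-almost $\frac1A$-ball of the full set, i.e. a ball that is a $c_q$-almost $\frac1A$-ball of the full set in every coloring consistent with the answers.
   Context: There are $n$ balls, each colored with one of two colors in an unknown way. For $0<\beta\le1$, a ball $b$ is a $\beta$-ball of a set $S$ of balls containing $b$ if there are at least $\beta(|S|-1)$ other balls in $S$ with the same color as $b$; for a constant $c$, $b$ is a $c$-almost $\beta$-ball of $S$ if there are at least $\beta(|S|-1)-c$ other balls in $S$ with the same color as $b$. A query is a set $Q$ of $q$ balls and the answer is (the index of) some $\alpha$-ball of $Q$, chosen adversarially. -}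

module Defs where

open import Data.Nat using (ℕ; zero; suc; _+_; _*_; _∸_; _≤_; _<_; _/_)
open import Data.Bool using (Bool; _∧_; not)
import Data.Bool as B
open import Data.Fin using (Fin; _≟_)
open import Data.Fin.Subset using (Subset; ∣_∣; _∩_; _∈_)
open import Data.Vec using (tabulate)
open import Data.Product using (_×_)
open import Relation.Nullary.Decidable using (⌊_⌋)
open import Relation.Nullary using (¬_)
open import Relation.Binary.PropositionalEquality using (_≡_)

-- ceiling division ⌈ q / B ⌉ for positive B (value 0 at B = 0, never used)
ceilDiv : ℕ → ℕ → ℕ
ceilDiv q zero    = 0
ceilDiv q (suc k) = (q + k) / suc k

Coloring : ℕ → Set
Coloring n = Fin n → Bool

sameAs : ∀ {n} → Coloring n → Fin n → Subset n
sameAs col b = tabulate (λ i → ⌊ col i B.≟ col b ⌋ ∧ not ⌊ i ≟ b ⌋)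

sameCount : ∀ {n} → Coloring n → Subset n → Fin n → ℕ
sameCount col S b = ∣ S ∩ sameAs col b ∣

-- b is an α-ball of S, where α = a / d  (d > 0):
--   b ∈ S  and  sameCount ≥ (a/d)(|S|-1)
IsAlphaBall : ∀ {n} → ℕ → ℕ → Coloring n → Subset n → Fin n → Set
IsAlphaBall a d col S b = b ∈ S × a * (∣ S ∣ ∸ 1) ≤ d * sameCount col S b

-- b is a c-almost (1/A)-ball of S:  sameCount ≥ (|S|-1)/A - c
IsAlmostInvBall : ∀ {n} → ℕ → ℕ → Coloring n → Subset n → Fin n → Set
IsAlmostInvBall c A col S b = b ∈ S × ∣ S ∣ ∸ 1 ≤ A * (sameCount col S b + c)

-- the condition  ⌈q/A⌉ - 1 ≥ α(q-1)  with α = a / d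
GoodA : ℕ → ℕ → ℕ → ℕ → Set
GoodA a d q A = a * (q ∸ 1) ≤ d * (ceilDiv q A ∸ 1)

IsLargestA : ℕ → ℕ → ℕ → ℕ → Set
IsLargestA a d q A = 1 ≤ A × GoodA a d q A × (∀ B → A < B → ¬ GoodA a d q B)

Answers : ℕ → ℕ → Set
Answers n q = (Q : Subset n) → ∣ Q ∣ ≡ q → Fin n

Consistent : ∀ {n q} → ℕ → ℕ → Coloring n → Answers n q → Set
Consistent {n} {q} a d col ans =
  (Q : Subset n) (p : ∣ Q ∣ ≡ q) → IsAlphaBall a d col Q (ans Q p)

{-# OPTIONS --safe #-}
module Submission where

-- Suppose no ball is safe: then every ball z has a consistent coloring whose colour class
-- W z of z is small, A ∣ W z ∣ + q² ≤ n.  The W z cover all balls.  Prune this cover twice,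
-- keeping only members with many private points (points in no other member).  If at most A
-- members survive, they cover at most n − q² balls while fewer than q² are uncovered, which
-- is impossible.  So at least A + 1 survive, each with m = ⌈q/(A+1)⌉ private points, and from
-- these we choose a query Q of q balls in which every ball lies in some W y meeting Q in at most
-- m balls.  In the coloring of y the answer to Q then has at most m − 1 companions in Q, so
-- consistency gives ⌈q/(A+1)⌉ − 1 ≥ α(q − 1), contradicting the maximality of A.  Everything
-- is finite, so safety of a ball is decidable and the contradiction yields an actual safe ball.

open import Defs
open import Data.Bool using (Bool; T; not; _∧_)
import Data.Bool as Bool
open import Data.Bool.Properties using (T-≡; T-∧)
open import Data.Empty using (⊥-elim)
open import Data.Fin using (Fin; zero; suc)
open import Data.Fin.Properties using (any?; all?; ¬∀⟶∃¬)
import Data.Fin.Properties as Fin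
open import Data.Fin.Subset
open import Data.Fin.Subset.Properties
open import Data.Fin.Subset.Induction using (⊂-wellFounded; Acc; acc)
open import Data.Nat hiding (_≟_; ∣_-_∣)
open import Data.Nat.Properties
open import Data.Nat.DivMod using (m≡m%n+[m/n]*n; m%n<n; m*n/n≡m; /-monoˡ-≤; m≥n⇒m/n>0)
open import Data.Product using (∃; ∃-syntax; _×_; _,_; proj₁; proj₂)
open import Data.Sum using (inj₁; inj₂)
open import Data.Vec using ([]; _∷_; here; there; tabulate; lookup)
open import Data.Vec.Properties using (lookup∘tabulate; lookup⇒[]=; []=⇒lookup; tabulate-cong)
open import Function using (_∘_; Equivalence)
open import Relation.Nullary using (¬_; Dec; yes; no; _×-dec_; ¬?)
open import Relation.Nullary.Decidable using (⌊_⌋; map′; decidable-stable; toWitness; fromWitness; toWitnessFalse; fromWitnessFalse)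
open import Relation.Unary using (Decidable)
open import Relation.Binary.PropositionalEquality

private variable
  k n : ℕ

∣p∪q∣≤∣p∣+∣q∣ : ∀ (p q : Subset n) → ∣ p ∪ q ∣ ≤ ∣ p ∣ + ∣ q ∣
∣p∪q∣≤∣p∣+∣q∣ []            []            = z≤n
∣p∪q∣≤∣p∣+∣q∣ (inside ∷ p)  (inside ∷ q)  = s≤s (≤-trans (∣p∪q∣≤∣p∣+∣q∣ p q) (+-monoʳ-≤ ∣ p ∣ (n≤1+n ∣ q ∣)))
∣p∪q∣≤∣p∣+∣q∣ (inside ∷ p)  (outside ∷ q) = s≤s (∣p∪q∣≤∣p∣+∣q∣ p q)
∣p∪q∣≤∣p∣+∣q∣ (outside ∷ p) (inside ∷ q)  = ≤-trans (s≤s (∣p∪q∣≤∣p∣+∣q∣ p q)) (≤-reflexive (sym (+-suc ∣ p ∣ ∣ q ∣)))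
∣p∪q∣≤∣p∣+∣q∣ (outside ∷ p) (outside ∷ q) = ∣p∪q∣≤∣p∣+∣q∣ p q

∣p∪q∣≡∣p∣+∣q∣ : ∀ (p q : Subset n) → Empty (p ∩ q) → ∣ p ∪ q ∣ ≡ ∣ p ∣ + ∣ q ∣
∣p∪q∣≡∣p∣+∣q∣ []            []            _ = refl
∣p∪q∣≡∣p∣+∣q∣ (inside ∷ p)  (inside ∷ q)  e = ⊥-elim (e (zero , here))
∣p∪q∣≡∣p∣+∣q∣ (inside ∷ p)  (outside ∷ q) e = cong suc (∣p∪q∣≡∣p∣+∣q∣ p q (drop-∷-Empty e))
∣p∪q∣≡∣p∣+∣q∣ (outside ∷ p) (inside ∷ q)  e = trans (cong suc (∣p∪q∣≡∣p∣+∣q∣ p q (drop-∷-Empty e))) (sym (+-suc ∣ p ∣ ∣ q ∣))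
∣p∪q∣≡∣p∣+∣q∣ (outside ∷ p) (outside ∷ q) e = ∣p∪q∣≡∣p∣+∣q∣ p q (drop-∷-Empty e)

lowest : ℕ → Subset n → Subset n
lowest zero    _             = ⊥
lowest (suc k) []            = []
lowest (suc k) (inside ∷ p)  = inside ∷ lowest k p
lowest (suc k) (outside ∷ p) = outside ∷ lowest (suc k) p

lowest⊆ : ∀ k (p : Subset n) → lowest k p ⊆ p
lowest⊆ zero    p             x∈ = ⊥-elim (∉⊥ x∈)
lowest⊆ (suc k) (inside ∷ p)  here        = here
lowest⊆ (suc k) (inside ∷ p)  (there x∈)  = there (lowest⊆ k p x∈)
lowest⊆ (suc k) (outside ∷ p) (there x∈)  = there (lowest⊆ (suc k) p x∈)

∣lowest∣≡ : ∀ {k} (p : Subset n) → k ≤ ∣ p ∣ → ∣ lowest k p ∣ ≡ k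
∣lowest∣≡ {n} {zero}  p             _  = ∣⊥∣≡0 n
∣lowest∣≡ {k = suc k} (inside ∷ p)  k≤ = cong suc (∣lowest∣≡ p (s≤s⁻¹ k≤))
∣lowest∣≡ {k = suc k} (outside ∷ p) k≤ = ∣lowest∣≡ p k≤

infix 10 ⋃[_]_

⋃[_]_ : Subset k → (Fin k → Subset n) → Subset n
⋃[ [] ]          W = ⊥
⋃[ inside ∷ Y ]  W = W zero ∪ ⋃[ Y ] (W ∘ suc)
⋃[ outside ∷ Y ] W = ⋃[ Y ] (W ∘ suc)

x∈⋃⁺ : ∀ {Y : Subset k} {W : Fin k → Subset n} {y x} → y ∈ Y → x ∈ W y → x ∈ ⋃[ Y ] W
x∈⋃⁺ {Y = inside ∷ Y}  here       x∈ = x∈p∪q⁺ (inj₁ x∈)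
x∈⋃⁺ {Y = inside ∷ Y}  (there y∈) x∈ = x∈p∪q⁺ (inj₂ (x∈⋃⁺ y∈ x∈))
x∈⋃⁺ {Y = outside ∷ Y} (there y∈) x∈ = x∈⋃⁺ y∈ x∈

x∈⋃⁻ : ∀ (Y : Subset k) (W : Fin k → Subset n) {x} → x ∈ ⋃[ Y ] W → ∃[ y ] y ∈ Y × x ∈ W y
x∈⋃⁻ []            W x∈ = ⊥-elim (∉⊥ x∈)
x∈⋃⁻ (inside ∷ Y) W x∈ with x∈p∪q⁻ (W zero) (⋃[ Y ] (W ∘ suc)) x∈
... | inj₁ x∈W₀ = zero , here , x∈W₀
... | inj₂ x∈⋃ = let y , y∈ , x∈W = x∈⋃⁻ Y (W ∘ suc) x∈⋃ in suc y , there y∈ , x∈W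
x∈⋃⁻ (outside ∷ Y) W x∈ = let y , y∈ , x∈W = x∈⋃⁻ Y (W ∘ suc) x∈ in suc y , there y∈ , x∈W

∣⋃∣-weighted-bound : ∀ (Y : Subset k) (W : Fin k → Subset n) {a b} →
                     (∀ {y} → y ∈ Y → a * ∣ W y ∣ ≤ b) → a * ∣ ⋃[ Y ] W ∣ ≤ ∣ Y ∣ * b
∣⋃∣-weighted-bound {n = n} []    W {a}     _ = ≤-reflexive (trans (cong (a *_) (∣⊥∣≡0 n)) (*-zeroʳ a))
∣⋃∣-weighted-bound (outside ∷ Y) W {a}     h = ∣⋃∣-weighted-bound Y (W ∘ suc) {a} (h ∘ there)
∣⋃∣-weighted-bound (inside ∷ Y)  W {a} {b} h = begin
  a * ∣ W zero ∪ U ∣          ≤⟨ *-monoʳ-≤ a (∣p∪q∣≤∣p∣+∣q∣ (W zero) U) ⟩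
  a * (∣ W zero ∣ + ∣ U ∣)    ≡⟨ *-distribˡ-+ a ∣ W zero ∣ ∣ U ∣ ⟩
  a * ∣ W zero ∣ + a * ∣ U ∣  ≤⟨ +-mono-≤ (h here) (∣⋃∣-weighted-bound Y (W ∘ suc) {a} (h ∘ there)) ⟩
  b + ∣ Y ∣ * b               ∎
  where
  open ≤-Reasoning
  U = ⋃[ Y ] (W ∘ suc)

PairwiseDisjointOn : Subset k → (Fin k → Subset n) → Set
PairwiseDisjointOn Y G = ∀ {y y′ x} → y ∈ Y → y′ ∈ Y → x ∈ G y → x ∈ G y′ → y ≡ y′

disjointOn-tail : ∀ {s} {Y : Subset k} {G : Fin (suc k) → Subset n} →
                  PairwiseDisjointOn (s ∷ Y) G → PairwiseDisjointOn Y (G ∘ suc)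
disjointOn-tail disj y∈ y′∈ x∈ x∈′ = Fin.suc-injective (disj (there y∈) (there y′∈) x∈ x∈′)

∣⋃∣-disjoint-bound : ∀ (Y : Subset k) (G : Fin k → Subset n) {v} → (∀ {y} → y ∈ Y → v ≤ ∣ G y ∣) →
                     PairwiseDisjointOn Y G → ∣ Y ∣ * v ≤ ∣ ⋃[ Y ] G ∣
∣⋃∣-disjoint-bound []            G     _     _    = z≤n
∣⋃∣-disjoint-bound (outside ∷ Y) G     large disj =
  ∣⋃∣-disjoint-bound Y (G ∘ suc) (large ∘ there) (disjointOn-tail disj)
∣⋃∣-disjoint-bound (inside ∷ Y)  G {v} large disj = begin
  v + ∣ Y ∣ * v          ≤⟨ +-mono-≤ (large here) (∣⋃∣-disjoint-bound Y (G ∘ suc) (large ∘ there) (disjointOn-tail disj)) ⟩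
  ∣ G zero ∣ + ∣ U ∣     ≡⟨ sym (∣p∪q∣≡∣p∣+∣q∣ (G zero) U apart) ⟩
  ∣ G zero ∪ U ∣         ∎
  where
  open ≤-Reasoning
  U = ⋃[ Y ] (G ∘ suc)
  apart : Empty (G zero ∩ U)
  apart (x , x∈) with x∈p∩q⁻ (G zero) U x∈
  ... | x∈G₀ , x∈⋃ with x∈⋃⁻ Y (G ∘ suc) x∈⋃
  ...   | y , y∈ , x∈G with () ← disj here (there y∈) x∈G₀ x∈G

module Covering (W : Fin k → Subset n) where

  uncovered : Subset k → Subset n
  uncovered Y = ∁ (⋃[ Y ] W)

  privatePart : Subset k → Fin k → Subset n
  privatePart Y y = W y ∩ uncovered (Y - y)

  privatePart⊆ : ∀ {Y y} → privatePart Y y ⊆ W y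
  privatePart⊆ {Y} {y} = proj₁ ∘ x∈p∩q⁻ (W y) _

  privatePart-unique : ∀ {Y y y′ x} → y′ ∈ Y → x ∈ privatePart Y y → x ∈ W y′ → y ≡ y′
  privatePart-unique {Y} {y} {y′} y′∈Y x∈ x∈W′ with y′ Fin.≟ y
  ... | yes y′≡y = sym y′≡y
  ... | no  y′≢y = ⊥-elim (x∈∁p⇒x∉p (proj₂ (x∈p∩q⁻ (W y) _ x∈)) (x∈⋃⁺ (x∈p∧x≢y⇒x∈p-y y′∈Y y′≢y) x∈W′))

  uncovered-remove : ∀ Y y → uncovered (Y - y) ⊆ uncovered Y ∪ privatePart Y y
  uncovered-remove Y y {x} x∈ with x ∈? ⋃[ Y ] W
  ... | no  x∉ = x∈p∪q⁺ (inj₁ (x∉p⇒x∈∁p x∉))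
  ... | yes x∈⋃ with x∈⋃⁻ Y W x∈⋃
  ...   | y′ , y′∈Y , x∈W′ with y′ Fin.≟ y
  ...     | yes refl = x∈p∪q⁺ (inj₂ (x∈p∩q⁺ (x∈W′ , x∈)))
  ...     | no  y′≢y = ⊥-elim (x∈∁p⇒x∉p x∈ (x∈⋃⁺ (x∈p∧x≢y⇒x∈p-y y′∈Y y′≢y) x∈W′))

  prune-step : ∀ {Y y s} → y ∈ Y → ∣ privatePart Y y ∣ ≤ s →
               ∣ uncovered (Y - y) ∣ + s * ∣ Y - y ∣ ≤ ∣ uncovered Y ∣ + s * ∣ Y ∣
  prune-step {Y} {y} {s} y∈Y few = begin
    ∣ uncovered (Y - y) ∣ + r                   ≤⟨ +-monoˡ-≤ r (p⊆q⇒∣p∣≤∣q∣ (uncovered-remove Y y)) ⟩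
    ∣ uncovered Y ∪ privatePart Y y ∣ + r       ≤⟨ +-monoˡ-≤ r (∣p∪q∣≤∣p∣+∣q∣ (uncovered Y) (privatePart Y y)) ⟩
    ∣ uncovered Y ∣ + ∣ privatePart Y y ∣ + r   ≤⟨ +-monoˡ-≤ r (+-monoʳ-≤ ∣ uncovered Y ∣ few) ⟩
    ∣ uncovered Y ∣ + s + r                     ≡⟨ +-assoc ∣ uncovered Y ∣ s r ⟩
    ∣ uncovered Y ∣ + (s + r)                   ≡⟨ cong (∣ uncovered Y ∣ +_) (sym (*-suc s ∣ Y - y ∣)) ⟩
    ∣ uncovered Y ∣ + s * suc ∣ Y - y ∣         ≤⟨ +-monoʳ-≤ ∣ uncovered Y ∣ (*-monoʳ-≤ s (x∈p⇒∣p-x∣<∣p∣ y∈Y)) ⟩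
    ∣ uncovered Y ∣ + s * ∣ Y ∣                 ∎
    where
    open ≤-Reasoning
    r = s * ∣ Y - y ∣

  prune : ∀ s (Y : Subset k) → ∃[ Z ] (∀ {y} → y ∈ Z → s < ∣ privatePart Z y ∣)
                                     × ∣ uncovered Z ∣ + s * ∣ Z ∣ ≤ ∣ uncovered Y ∣ + s * ∣ Y ∣
  prune s Y = go Y (⊂-wellFounded Y)
    where
    go : ∀ Y → Acc _⊂_ Y → ∃[ Z ] (∀ {y} → y ∈ Z → s < ∣ privatePart Z y ∣)
                                × ∣ uncovered Z ∣ + s * ∣ Z ∣ ≤ ∣ uncovered Y ∣ + s * ∣ Y ∣
    go Y (acc rec) with any? (λ y → y ∈? Y ×-dec ∣ privatePart Y y ∣ ≤? s)
    ... | yes (y , y∈Y , few) =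
      let Z , large , potential = go (Y - y) (rec (x∈p⇒p-x⊂p y∈Y))
      in  Z , large , ≤-trans potential (prune-step y∈Y few)
    ... | no none = Y , (λ y∈Y → ≰⇒> (λ few → none (_ , y∈Y , few))) , ≤-refl

  Sparse : ℕ → Subset n → Set
  Sparse m Q = ∀ {x} → x ∈ Q → ∃[ y ] x ∈ W y × ∣ Q ∩ W y ∣ ≤ m

  -- Take v private points of every member of Y; since private parts are pairwise
  -- disjoint, a set W y meets the q lowest of them only in the v chosen for y.
  sparse-from-privateParts : ∀ {Y v m q} → v ≤ m → (∀ {y} → y ∈ Y → v ≤ ∣ privatePart Y y ∣) →
                             q ≤ ∣ Y ∣ * v → ∃[ Q ] ∣ Q ∣ ≡ q × Sparse m Q
  sparse-from-privateParts {Y} {v} {m} {q} v≤m large q≤ = Q , ∣lowest∣≡ U q≤∣U∣ , sparse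
    where
    G : Fin k → Subset n
    G y = lowest v (privatePart Y y)
    U = ⋃[ Y ] G
    Q = lowest q U
    G⊆W : ∀ {y} → G y ⊆ W y
    G⊆W {y} = privatePart⊆ {Y} ∘ lowest⊆ v (privatePart Y y)
    ∣G∣≡v : ∀ {y} → y ∈ Y → ∣ G y ∣ ≡ v
    ∣G∣≡v y∈Y = ∣lowest∣≡ _ (large y∈Y)
    G-unique : ∀ {y y′ x} → y′ ∈ Y → x ∈ G y → x ∈ W y′ → y ≡ y′
    G-unique y′∈Y x∈G = privatePart-unique y′∈Y (lowest⊆ v _ x∈G)
    q≤∣U∣ : q ≤ ∣ U ∣
    q≤∣U∣ = ≤-trans q≤ (∣⋃∣-disjoint-bound Y G (≤-reflexive ∘ sym ∘ ∣G∣≡v)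
                                             (λ _ y′∈Y x∈G x∈G′ → G-unique y′∈Y x∈G (G⊆W x∈G′)))
    sparse : Sparse m Q
    sparse x∈Q with x∈⋃⁻ Y G (lowest⊆ q U x∈Q)
    ... | y , y∈Y , x∈G = y , G⊆W x∈G , ≤-trans (p⊆q⇒∣p∣≤∣q∣ Q∩W⊆G) (≤-trans (≤-reflexive (∣G∣≡v y∈Y)) v≤m)
      where
      Q∩W⊆G : Q ∩ W y ⊆ G y
      Q∩W⊆G x′∈ with x∈p∩q⁻ Q (W y) x′∈
      ... | x′∈Q , x′∈W with x∈⋃⁻ Y G (lowest⊆ q U x′∈Q)
      ...   | y′ , _ , x′∈G′ = subst (λ z → _ ∈ G z) (G-unique y∈Y x′∈G′ x′∈W) x′∈G′

  ∣uncovered∣<⇒A<∣Y∣ : ∀ {Y A D} → 1 ≤ A → D ≤ n → (∀ y → A * ∣ W y ∣ + D ≤ n) →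
                       ∣ uncovered Y ∣ < D → A < ∣ Y ∣
  ∣uncovered∣<⇒A<∣Y∣ {Y} {A} {D} A≥1 D≤n small few with ∣ Y ∣ ≤? A
  ... | no  ∣Y∣≰A = ≰⇒> ∣Y∣≰A
  ... | yes ∣Y∣≤A = ⊥-elim (<-irrefl refl n<n)
    where
    instance _ = >-nonZero A≥1
    covered≤ : ∣ ⋃[ Y ] W ∣ ≤ n ∸ D
    covered≤ = *-cancelˡ-≤ A (≤-trans (∣⋃∣-weighted-bound Y W {A} (λ {y} _ → m+n≤o⇒m≤o∸n (A * ∣ W y ∣) (small y)))
                                      (*-monoˡ-≤ (n ∸ D) ∣Y∣≤A))
    n<n : n < n
    n<n = begin-strict
      n                                       ≡⟨ sym (m+[n∸m]≡n (∣p∣≤n (⋃[ Y ] W))) ⟩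
      ∣ ⋃[ Y ] W ∣ + (n ∸ ∣ ⋃[ Y ] W ∣)       ≡⟨ cong (∣ ⋃[ Y ] W ∣ +_) (sym (∣∁p∣≡n∸∣p∣ (⋃[ Y ] W))) ⟩
      ∣ ⋃[ Y ] W ∣ + ∣ uncovered Y ∣          <⟨ +-mono-≤-< covered≤ few ⟩
      n ∸ D + D                               ≡⟨ m∸n+n≡m D≤n ⟩
      n                                       ∎
      where open ≤-Reasoning

  -- First prune to a cover in which every member has a private point; if it has at least
  -- q members we are done, otherwise prune again, now keeping only members with m private points.
  sparse-exists : ∀ {A m q} → 1 ≤ A → 1 ≤ m → q ≤ suc A * m → m * q ≤ n →
                  (∀ y → A * ∣ W y ∣ + m * q ≤ n) → Empty (uncovered ⊤) → ∃[ Q ] ∣ Q ∣ ≡ q × Sparse m Q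
  sparse-exists {A} {suc s} {q} A≥1 (s≤s _) q≤ mq≤n small covers with prune 0 ⊤
  ... | Y₁ , large₁ , potential₁ with q ≤? ∣ Y₁ ∣
  ...   | yes q≤∣Y₁∣ = sparse-from-privateParts (s≤s z≤n) large₁ (subst (q ≤_) (sym (*-identityʳ _)) q≤∣Y₁∣)
  ...   | no  q≰∣Y₁∣ with prune s Y₁
  ...     | Y₂ , large₂ , potential₂ =
    sparse-from-privateParts ≤-refl large₂ (≤-trans q≤ (*-monoˡ-≤ (suc s) (∣uncovered∣<⇒A<∣Y∣ {Y₂} A≥1 mq≤n small few)))
      where
      ∣Y₁∣<q = ≰⇒> q≰∣Y₁∣
      uncovered₁≡0 : ∣ uncovered Y₁ ∣ ≡ 0
      uncovered₁≡0 = n≤0⇒n≡0 (begin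
        ∣ uncovered Y₁ ∣       ≤⟨ m≤m+n _ 0 ⟩
        ∣ uncovered Y₁ ∣ + 0   ≤⟨ potential₁ ⟩
        ∣ uncovered ⊤ ∣ + 0    ≡⟨ cong (λ U → ∣ U ∣ + 0) (Empty-unique covers) ⟩
        ∣ ⊥ {n} ∣ + 0          ≡⟨ cong (_+ 0) (∣⊥∣≡0 n) ⟩
        0                      ∎)
        where open ≤-Reasoning
      few : ∣ uncovered Y₂ ∣ < suc s * q
      few = begin-strict
        ∣ uncovered Y₂ ∣                   ≤⟨ m≤m+n _ _ ⟩
        ∣ uncovered Y₂ ∣ + s * ∣ Y₂ ∣      ≤⟨ potential₂ ⟩
        ∣ uncovered Y₁ ∣ + s * ∣ Y₁ ∣      ≡⟨ cong (_+ s * ∣ Y₁ ∣) uncovered₁≡0 ⟩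
        s * ∣ Y₁ ∣                         ≤⟨ *-monoʳ-≤ s (<⇒≤ ∣Y₁∣<q) ⟩
        s * q                              <⟨ m<n+m (s * q) (≤-<-trans z≤n ∣Y₁∣<q) ⟩
        q + s * q                          ∎
        where open ≤-Reasoning

colorClass : Coloring n → Fin n → Subset n
colorClass col b = tabulate (λ i → ⌊ col i Bool.≟ col b ⌋)

∈-tabulate⁺ : ∀ {f : Fin n → Bool} {i} → T (f i) → i ∈ tabulate f
∈-tabulate⁺ {f = f} {i} t = lookup⇒[]= i (tabulate f) (trans (lookup∘tabulate f i) (Equivalence.to T-≡ t))

∈-tabulate⁻ : ∀ {f : Fin n → Bool} {i} → i ∈ tabulate f → T (f i)
∈-tabulate⁻ {f = f} {i} i∈ = Equivalence.from T-≡ (trans (sym (lookup∘tabulate f i)) ([]=⇒lookup i∈))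

module _ {col : Coloring n} {i b : Fin n} where

  ∈-colorClass⁺ : col i ≡ col b → i ∈ colorClass col b
  ∈-colorClass⁺ = ∈-tabulate⁺ ∘ fromWitness

  ∈-colorClass⁻ : i ∈ colorClass col b → col i ≡ col b
  ∈-colorClass⁻ = toWitness ∘ ∈-tabulate⁻

  ∈-sameAs⁺ : col i ≡ col b → i ≢ b → i ∈ sameAs col b
  ∈-sameAs⁺ same i≢b = ∈-tabulate⁺ (Equivalence.from T-∧
    (fromWitness {a? = col i Bool.≟ col b} same , fromWitnessFalse {a? = i Fin.≟ b} i≢b))

  ∈-sameAs⁻ : i ∈ sameAs col b → col i ≡ col b × i ≢ b
  ∈-sameAs⁻ i∈ = let same , distinct = Equivalence.to (T-∧ {⌊ col i Bool.≟ col b ⌋}) (∈-tabulate⁻ i∈)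
                 in  toWitness same , toWitnessFalse distinct

∣colorClass∣≤1+sameCount : ∀ (col : Coloring n) b → ∣ colorClass col b ∣ ≤ suc (sameCount col ⊤ b)
∣colorClass∣≤1+sameCount col b = begin
  ∣ colorClass col b ∣            ≤⟨ p⊆q⇒∣p∣≤∣q∣ class⊆ ⟩
  ∣ ⁅ b ⁆ ∪ sameAs col b ∣        ≤⟨ ∣p∪q∣≤∣p∣+∣q∣ ⁅ b ⁆ (sameAs col b) ⟩
  ∣ ⁅ b ⁆ ∣ + ∣ sameAs col b ∣    ≡⟨ cong₂ _+_ (∣⁅x⁆∣≡1 b) (cong ∣_∣ (sym (∩-identityˡ (sameAs col b)))) ⟩
  suc (sameCount col ⊤ b)         ∎
  where
  open ≤-Reasoning
  class⊆ : colorClass col b ⊆ ⁅ b ⁆ ∪ sameAs col b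
  class⊆ {i} i∈ with i Fin.≟ b
  ... | yes refl = x∈p∪q⁺ (inj₁ (x∈⁅x⁆ b))
  ... | no  i≢b  = x∈p∪q⁺ (inj₂ (∈-sameAs⁺ (∈-colorClass⁻ i∈) i≢b))

sameCount<∣∩colorClass∣ : ∀ (col : Coloring n) {Q x y} → x ∈ Q → x ∈ colorClass col y →
                          sameCount col Q x < ∣ Q ∩ colorClass col y ∣
sameCount<∣∩colorClass∣ col {Q} {x} {y} x∈Q x∈C =
  ≤-<-trans (p⊆q⇒∣p∣≤∣q∣ ⊆minus) (x∈p⇒∣p-x∣<∣p∣ (x∈p∩q⁺ (x∈Q , x∈C)))
  where
  ⊆minus : Q ∩ sameAs col x ⊆ (Q ∩ colorClass col y) - x
  ⊆minus i∈ with x∈p∩q⁻ Q _ i∈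
  ... | i∈Q , i∈S with ∈-sameAs⁻ i∈S
  ...   | same , i≢x = x∈p∧x≢y⇒x∈p-y (x∈p∩q⁺ (i∈Q , ∈-colorClass⁺ (trans same (∈-colorClass⁻ x∈C)))) i≢x

allSubsets? : ∀ {P : Subset n → Set} → Decidable P → Dec (∀ Q → P Q)
allSubsets? P? with anySubset? (¬? ∘ P?)
... | yes (Q , ¬PQ) = no (λ all → ¬PQ (all Q))
... | no  none      = yes (λ Q → decidable-stable (P? Q) (λ ¬PQ → none (Q , ¬PQ)))

-- Colorings are functions, so they are enumerated as vectors; without function
-- extensionality the predicate has to respect pointwise equality.
anyColoring? : ∀ {P : Coloring n → Set} → (∀ {col col′} → col ≗ col′ → P col → P col′) →
               Decidable P → Dec (∃ P)
anyColoring? resp P? = map′ (λ (v , Pv) → lookup v , Pv)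
                            (λ (col , Pcol) → tabulate col , resp (sym ∘ lookup∘tabulate col) Pcol)
                            (anySubset? (P? ∘ lookup))

sameCount-cong : ∀ {col col′ : Coloring n} → col ≗ col′ → ∀ S b → sameCount col S b ≡ sameCount col′ S b
sameCount-cong eq S b = cong (λ T → ∣ S ∩ T ∣)
  (tabulate-cong (λ i → cong₂ (λ u v → ⌊ u Bool.≟ v ⌋ ∧ not ⌊ i Fin.≟ b ⌋) (eq i) (eq b)))

module _ (a d : ℕ) where

  isAlphaBall? : ∀ (col : Coloring n) S b → Dec (IsAlphaBall a d col S b)
  isAlphaBall? col S b = b ∈? S ×-dec a * (∣ S ∣ ∸ 1) ≤? d * sameCount col S b

  IsAlphaBall-cong : ∀ {col col′ : Coloring n} → col ≗ col′ → ∀ {S b} →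
                     IsAlphaBall a d col S b → IsAlphaBall a d col′ S b
  IsAlphaBall-cong eq {S} {b} (b∈S , many) = b∈S , subst (λ t → a * (∣ S ∣ ∸ 1) ≤ d * t) (sameCount-cong eq S b) many

  consistent? : ∀ {q} (col : Coloring n) (ans : Answers n q) → Dec (Consistent a d col ans)
  consistent? {q = q} col ans = allSubsets? answered?
    where
    answered? : ∀ Q → Dec ((p : ∣ Q ∣ ≡ q) → IsAlphaBall a d col Q (ans Q p))
    answered? Q with ∣ Q ∣ ≟ q
    ... | no  ∣Q∣≢q = yes (⊥-elim ∘ ∣Q∣≢q)
    ... | yes p     = map′ (λ h p′ → subst (IsAlphaBall a d col Q ∘ ans Q) (≡-irrelevant p p′) h) (λ h → h p)
                           (isAlphaBall? col Q (ans Q p))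

module _ (c A : ℕ) where

  isAlmostInvBall? : ∀ (col : Coloring n) S b → Dec (IsAlmostInvBall c A col S b)
  isAlmostInvBall? col S b = b ∈? S ×-dec ∣ S ∣ ∸ 1 ≤? A * (sameCount col S b + c)

  IsAlmostInvBall-cong : ∀ {col col′ : Coloring n} → col ≗ col′ → ∀ {S b} →
                         IsAlmostInvBall c A col S b → IsAlmostInvBall c A col′ S b
  IsAlmostInvBall-cong eq {S} {b} (b∈S , many) =
    b∈S , subst (λ t → ∣ S ∣ ∸ 1 ≤ A * (t + c)) (sameCount-cong eq S b) many

q≤[1+A]*ceilDiv : ∀ q A → q ≤ suc A * ceilDiv q (suc A)
q≤[1+A]*ceilDiv q A = +-cancelʳ-≤ A q _ (begin
  q + A                                          ≡⟨ m≡m%n+[m/n]*n (q + A) (suc A) ⟩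
  (q + A) % suc A + ceilDiv q (suc A) * suc A    ≤⟨ +-monoˡ-≤ _ (m<1+n⇒m≤n (m%n<n (q + A) (suc A))) ⟩
  A + ceilDiv q (suc A) * suc A                  ≡⟨ +-comm A _ ⟩
  ceilDiv q (suc A) * suc A + A                  ≡⟨ cong (_+ A) (*-comm _ (suc A)) ⟩
  suc A * ceilDiv q (suc A) + A                  ∎)
  where open ≤-Reasoning

ceilDiv≤q : ∀ {q} A → 1 ≤ q → ceilDiv q (suc A) ≤ q
ceilDiv≤q {q} A q≥1 = begin
  (q + A) / suc A       ≤⟨ /-monoˡ-≤ (suc A) (+-monoʳ-≤ q (m≤n*m A q)) ⟩
  (q + q * A) / suc A   ≡⟨ cong (_/ suc A) (sym (*-suc q A)) ⟩
  q * suc A / suc A     ≡⟨ m*n/n≡m q (suc A) ⟩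
  q                     ∎
  where
  open ≤-Reasoning
  instance _ = >-nonZero q≥1

1≤ceilDiv : ∀ {q} A → 1 ≤ q → 1 ≤ ceilDiv q (suc A)
1≤ceilDiv A q≥1 = m≥n⇒m/n>0 (+-monoˡ-≤ A q≥1)

n∸1≰A*[s+c]⇒A*[1+s]+c≤n : ∀ {A c s N} → 1 ≤ A → 1 ≤ c → ¬ (N ∸ 1 ≤ A * (s + c)) → A * suc s + c ≤ N
n∸1≰A*[s+c]⇒A*[1+s]+c≤n {A@(suc _)} {suc c} {s} {N} _ _ notAlmost = begin
  A * suc s + suc c          ≡⟨ +-suc _ c ⟩
  suc (A * suc s + c)        ≤⟨ s≤s (+-monoʳ-≤ _ (m≤n*m c A)) ⟩
  suc (A * suc s + A * c)    ≡⟨ cong suc (sym (*-distribˡ-+ A (suc s) c)) ⟩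
  suc (A * (suc s + c))      ≡⟨ cong (λ t → suc (A * t)) (sym (+-suc s c)) ⟩
  suc (A * (s + suc c))      ≤⟨ ≰⇒> notAlmost ⟩
  N ∸ 1                      ≤⟨ m∸n≤m N 1 ⟩
  N                          ∎
  where open ≤-Reasoning

Refutes : ∀ {q} → ℕ → ℕ → ℕ → ℕ → Answers n q → Fin n → Coloring n → Set
Refutes a d c A ans z col = Consistent a d col ans × ¬ IsAlmostInvBall c A col ⊤ z

refutable? : ∀ {q} a d c A (ans : Answers n q) z → Dec (∃ (Refutes a d c A ans z))
refutable? a d c A ans z =
  anyColoring? respects (λ col → consistent? a d col ans ×-dec ¬? (isAlmostInvBall? c A col ⊤ z))
  where
  respects : ∀ {col col′} → col ≗ col′ → Refutes a d c A ans z col → Refutes a d c A ans z col′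
  respects eq (consistent , notAlmost) =
    (λ Q p → IsAlphaBall-cong a d eq (consistent Q p)) , notAlmost ∘ IsAlmostInvBall-cong c A (sym ∘ eq)

answer-bound : ∀ {a d q m} (ans : Answers n q) (col : Fin n → Coloring n) →
               (∀ z → Consistent a d (col z) ans) →
               ∀ {Q} (p : ∣ Q ∣ ≡ q) → Covering.Sparse (λ z → colorClass (col z) z) m Q →
               a * (q ∸ 1) ≤ d * (m ∸ 1)
answer-bound {a = a} {d} {q} {m} ans col consistent {Q} p sparse with sparse (proj₁ (consistent (ans Q p) Q p))
... | y , x∈W , ∣Q∩W∣≤m = begin
  a * (q ∸ 1)                       ≡⟨ cong (λ t → a * (t ∸ 1)) (sym p) ⟩
  a * (∣ Q ∣ ∸ 1)                   ≤⟨ proj₂ (consistent y Q p) ⟩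
  d * sameCount (col y) Q (ans Q p) ≤⟨ *-monoʳ-≤ d (∸-monoˡ-≤ 1 (≤-trans fewer ∣Q∩W∣≤m)) ⟩
  d * (m ∸ 1)                       ∎
  where
  open ≤-Reasoning
  fewer = sameCount<∣∩colorClass∣ (col y) (proj₁ (consistent (ans Q p) Q p)) x∈W

allRefuted⇒GoodA : ∀ {a d q A n} → 1 ≤ q → 1 ≤ A → (ans : Answers (suc n) q) →
                   (∀ z → ∃ (Refutes a d (q * q) A ans z)) → GoodA a d q (suc A)
allRefuted⇒GoodA {a} {d} {q} {A} {n} q≥1 A≥1 ans refuted =
  let Q , ∣Q∣≡q , sparse = sparse-exists A≥1 (1≤ceilDiv A q≥1) (q≤[1+A]*ceilDiv q A)
                                         (≤-trans (m≤n+m _ _) (small zero)) small covers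
  in  answer-bound {a = a} {d} ans col (λ z → proj₁ (proj₂ (refuted z))) ∣Q∣≡q sparse
  where
  m = ceilDiv q (suc A)
  col : Fin (suc n) → Coloring (suc n)
  col = proj₁ ∘ refuted
  W : Fin (suc n) → Subset (suc n)
  W z = colorClass (col z) z
  open Covering W
  covers : Empty (uncovered ⊤)
  covers (x , x∈) = x∈∁p⇒x∉p x∈ (x∈⋃⁺ {W = W} ∈⊤ (∈-colorClass⁺ {col = col x} refl))
  small : ∀ z → A * ∣ W z ∣ + m * q ≤ suc n
  small z = begin
    A * ∣ W z ∣ + m * q                        ≤⟨ +-mono-≤ (*-monoʳ-≤ A (∣colorClass∣≤1+sameCount (col z) z))
                                                            (*-monoˡ-≤ q (ceilDiv≤q A q≥1)) ⟩
    A * suc (sameCount (col z) ⊤ z) + q * q    ≤⟨ n∸1≰A*[s+c]⇒A*[1+s]+c≤n A≥1 (*-mono-≤ q≥1 q≥1)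
                                                    (λ h → proj₂ (proj₂ (refuted z)) (∈⊤ , h)) ⟩
    ∣ ⊤ {suc n} ∣                              ≡⟨ ∣⊤∣≡n (suc n) ⟩
    suc n                                      ∎
    where open ≤-Reasoning

safeBall-exists : ∀ {a d q A n} → 1 ≤ q → 1 ≤ A → ¬ GoodA a d q (suc A) → (ans : Answers (suc n) q) →
                  ∃[ b ] ((col : Coloring (suc n)) → Consistent a d col ans → IsAlmostInvBall (q * q) A col ⊤ b)
safeBall-exists {a} {d} {q} {A} {n} q≥1 A≥1 notGood ans with all? (refutable? a d (q * q) A ans)
... | yes allRefuted = ⊥-elim (notGood (allRefuted⇒GoodA {a} {d} q≥1 A≥1 ans allRefuted))
... | no  notAllRefuted =
  let z , unrefuted = ¬∀⟶∃¬ (suc n) _ (refutable? a d (q * q) A ans) notAllRefuted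
  in  z , λ col consistent → decidable-stable (isAlmostInvBall? (q * q) A col ⊤ z)
                                               (λ notAlmost → unrefuted (col , consistent , notAlmost))

theorem19 : (q : ℕ) → 1 ≤ q →
    ∃[ c ] ((a d : ℕ) → 0 < a → 2 * a ≤ d →
      (A : ℕ) → IsLargestA a d q A →
      ∃[ N ] ((n : ℕ) → N ≤ n → (ans : Answers n q) →
        ∃[ b ] ((col : Coloring n) → Consistent a d col ans →
          IsAlmostInvBall c A col ⊤ b)))
theorem19 q q≥1 = q * q , λ a d _ _ A (A≥1 , _ , maximal) →
  1 , λ { zero () ; (suc n) _ ans → safeBall-exists {a} {d} q≥1 A≥1 (maximal (suc A) ≤-refl) ans }
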